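{- Let $n,q$ be integers with $q\geq n\geq 3$. Then $b(H(n,q))=n+1$.
   Context: For positive integers $n,q$, the Hamming graph $H(n,q)$ has vertex set $\{1,\ldots,q\}^n$, two vertices adjacent iff they differ in exactly one coordinate; $d(u,v)$ is the graph (Hamming) distance. For a finite graph $G$ with vertex set $V$, a vertex $v$ and integer $k\geq 0$, $\Gamma_k(v)=\{u\in V: d(u,v)\leq k\}$. A sequence $(v_1,\ldots,v_b)$ of vertices is a burning sequence of length $b$ if $\Gamma_{b-1}(v_1)\cup\Gamma_{b-2}(v_2)\cup\cdots\cup\Gamma_0(v_b)=V$, and the burning number $b(G)$ is the minimum length of a burning sequence. -}

module Defs where

open import Data.Nat using (ℕ; zero; suc; _+_; _∸_; _≤_; _<_)
open import Data.Fin using (Fin)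
open import Data.Fin.Properties using (_≟_)
open import Data.Vec using (Vec; []; _∷_; lookup; length)
open import Data.Product using (Σ; ∃; _×_)
open import Relation.Nullary using (¬_; does)
open import Data.Bool using (if_then_else_)

-- Vertices of the Hamming graph H(n,q): words of length n over an alphabet of size q
Vertex : ℕ → ℕ → Set
Vertex n q = Vec (Fin q) n

-- Hamming distance (= graph distance in H(n,q)): number of differing coordinates
hamming : ∀ {n q} → Vertex n q → Vertex n q → ℕ
hamming [] [] = 0
hamming (x ∷ xs) (y ∷ ys) = (if does (x ≟ y) then 0 else 1) + hamming xs ys

-- A sequence (v_1,...,v_b), encoded as Vec (Vertex n q) b with 0-based index i,
-- is a burning sequence iff every vertex u satisfies d(u, v_{i+1}) ≤ b-1-i for some i.
IsBurningSequence : ∀ {n q b} → Vec (Vertex n q) b → Set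
IsBurningSequence {n} {q} {b} vs =
  (u : Vertex n q) → ∃ λ (i : Fin b) →
    hamming u (lookup vs i) ≤ b ∸ 1 ∸ Data.Fin.toℕ i

BurningNumberIs : ℕ → ℕ → ℕ → Set
BurningNumberIs n q b =
  (Σ (Vec (Vertex n q) b) IsBurningSequence) ×
  ((b' : ℕ) → b' < b → ¬ Σ (Vec (Vertex n q) b') IsBurningSequence)

{-# OPTIONS --safe #-}
-- Every vertex is within distance n of any other, so a sequence of length n + 1 burns
-- H(n,q) from its first vertex. Conversely, burning sequences can be lengthened, so it
-- suffices to defeat a sequence v₀,…,v_{n-1} of length n, where vᵢ burns radius n-1-i. Since
-- fewer than q letters can be avoided in each coordinate, there is a vertex u whose first
-- letter differs from that of every vᵢ except v₁ and whose other letters differ from those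
-- of every vᵢ except v_{n-1}. Then d(u,vᵢ) ≥ n - i for every i (this needs n ≥ 3, so that
-- v₁ and v_{n-1} are distinct), and u is never reached.
module Submission where

open import Defs
open import Data.Nat using (ℕ; zero; suc; _+_; _∸_; _≤_; _<_; _≤′_; ≤′-refl; ≤′-step; z≤n; s≤s)
open import Data.Nat.Properties
  using (≤-refl; ≤-trans; n≤1+n; <⇒≱; m≤n+m; n<1+n; +-monoʳ-≤; +-comm; ∸-+-assoc; m+[n∸m]≡n; ≤⇒≤′; ≤-pred; module ≤-Reasoning)
open import Data.Fin using (Fin; zero; suc; toℕ; fromℕ; fromℕ<; punchIn; punchOut)
open import Data.Fin.Properties using (_≟_; all?; any?; ¬∀⟶∃¬; pigeonhole; <⇒≢; toℕ<n; toℕ-fromℕ; punchIn-punchOut)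
open import Data.Vec using (Vec; []; _∷_; lookup; head; tail; replicate)
open import Data.Product using (Σ; ∃; _,_; proj₁; proj₂)
open import Data.Bool using (true; false)
open import Function using (_∘_)
open import Relation.Nullary using (¬_; does; yes; no; contradiction)
open import Relation.Binary.PropositionalEquality using (_≡_; _≢_; refl; sym; trans; cong; subst)

private
  variable
    n q b : ℕ

avoid : ∀ {k} → k < q → (f : Fin k → Fin q) → ∃ λ y → ∀ i → f i ≢ y
avoid {q} k<q f with all? (λ y → any? (λ i → f i ≟ y))
... | yes surjective with pigeonhole k<q (proj₁ ∘ surjective)
...   | y , y′ , y<y′ , same-preimage = contradiction
          (trans (sym (proj₂ (surjective y))) (trans (cong f same-preimage) (proj₂ (surjective y′))))
          (<⇒≢ y<y′)
avoid {q} k<q f | no ¬surjective with ¬∀⟶∃¬ q _ (λ y → any? (λ i → f i ≟ y)) ¬surjective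
... | y , ¬hit = y , λ i fi≡y → ¬hit (i , fi≡y)

avoid-except : ∀ {k} → k < q → (p : Fin (suc k)) (f : Fin (suc k) → Fin q) →
               ∃ λ y → ∀ i → i ≢ p → f i ≢ y
avoid-except k<q p f with avoid k<q (f ∘ punchIn p)
... | y , avoids = y , λ i i≢p →
  subst (λ j → f j ≢ y) (punchIn-punchOut (i≢p ∘ sym)) (avoids (punchOut (i≢p ∘ sym)))

hamming-∷-≢ : ∀ x (u : Vertex n q) (v : Vertex (suc n) q) → x ≢ head v →
              hamming (x ∷ u) v ≡ suc (hamming u (tail v))
hamming-∷-≢ x u (y ∷ v) x≢y with x ≟ y
... | yes x≡y = contradiction x≡y x≢y
... | no _    = refl

hamming-tail-≤ : ∀ x (u : Vertex n q) (v : Vertex (suc n) q) → hamming u (tail v) ≤ hamming (x ∷ u) v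
hamming-tail-≤ x u (y ∷ v) = m≤n+m _ _

hamming-[] : (v : Vertex 0 q) → hamming [] v ≡ 0
hamming-[] [] = refl

hamming-≤ : (u v : Vertex n q) → hamming u v ≤ n
hamming-≤ []      []      = z≤n
hamming-≤ (x ∷ u) (y ∷ v) with does (x ≟ y)
... | true  = ≤-trans (hamming-≤ u v) (n≤1+n _)
... | false = s≤s (hamming-≤ u v)

antipodal-except : ∀ {k} → k < q → (p : Fin (suc k)) (F : Fin (suc k) → Vertex n q) →
                   ∃ λ u → ∀ i → i ≢ p → hamming u (F i) ≡ n
antipodal-except {n = zero}  k<q p F = [] , λ i _ → hamming-[] (F i)
antipodal-except {n = suc n} k<q p F
  with avoid-except k<q p (head ∘ F) | antipodal-except k<q p (tail ∘ F)
... | x , x-avoids | u , u-antipodal = x ∷ u , λ i i≢p →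
  trans (hamming-∷-≢ x u (F i) (x-avoids i i≢p ∘ sym)) (cong suc (u-antipodal i i≢p))

burns-from-head : (vs : Vec (Vertex n q) (suc b)) → n ≤ b → IsBurningSequence vs
burns-from-head vs n≤b u = zero , ≤-trans (hamming-≤ u (lookup vs zero)) n≤b

burning-∷ : (w : Vertex n q) {vs : Vec (Vertex n q) b} → IsBurningSequence vs → IsBurningSequence (w ∷ vs)
burning-∷ {b = b} w {vs} burns u with burns u
... | i , within = suc i , subst (hamming u (lookup vs i) ≤_) (∸-+-assoc b 1 (toℕ i)) within

burning-lengthen : ∀ {m} → Vertex n q → b ≤′ m →
                   Σ (Vec (Vertex n q) b) IsBurningSequence → Σ (Vec (Vertex n q) m) IsBurningSequence
burning-lengthen w ≤′-refl          burning = burning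
burning-lengthen w (≤′-step b≤′m) burning with burning-lengthen w b≤′m burning
... | vs , burns = w ∷ vs , burning-∷ w burns

beyond-radius : ∀ {d} (i : Fin b) → b ≤ toℕ i + d → ¬ (d ≤ b ∸ 1 ∸ toℕ i)
beyond-radius {b} {d} i b≤i+d d≤radius = <⇒≱ i+d<b b≤i+d
  where
  open ≤-Reasoning
  i+d<b : toℕ i + d < b
  i+d<b = begin-strict
    toℕ i + d                       ≤⟨ +-monoʳ-≤ (toℕ i) d≤radius ⟩
    toℕ i + (b ∸ 1 ∸ toℕ i)         ≡⟨ cong (toℕ i +_) (∸-+-assoc b 1 (toℕ i)) ⟩
    toℕ i + (b ∸ suc (toℕ i))       <⟨ n<1+n _ ⟩
    suc (toℕ i) + (b ∸ suc (toℕ i)) ≡⟨ m+[n∸m]≡n (toℕ<n i) ⟩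
    b                               ∎

unreached⇒¬burning : {vs : Vec (Vertex n q) b} (u : Vertex n q) →
                     (∀ i → b ≤ toℕ i + hamming u (lookup vs i)) → ¬ IsBurningSequence vs
unreached⇒¬burning u unreached burns with burns u
... | i , within = beyond-radius i (unreached i) within

unreached-vertex : 3 ≤ n → n ≤ q → (vs : Vec (Vertex n q) n) →
                   ∃ λ u → ∀ i → n ≤ toℕ i + hamming u (lookup vs i)
unreached-vertex {suc (suc (suc m))} (s≤s (s≤s (s≤s z≤n))) n≤q vs
  with avoid-except n≤q (suc zero) (head ∘ lookup vs)
     | antipodal-except n≤q (fromℕ (suc (suc m))) (tail ∘ lookup vs)
... | x , x-avoids | u , u-antipodal = x ∷ u , unreached
  where
  open ≤-Reasoning
  last : Fin (suc (suc (suc m)))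
  last = fromℕ (suc (suc m))
  unreached : ∀ i → suc (suc (suc m)) ≤ toℕ i + hamming (x ∷ u) (lookup vs i)
  unreached i with i ≟ last
  ... | yes refl = begin
    suc (suc (suc m))                               ≡⟨ +-comm 1 (suc (suc m)) ⟩
    suc (suc m) + 1                                 ≡⟨ cong (_+ 1) (sym (toℕ-fromℕ (suc (suc m)))) ⟩
    toℕ last + 1                                    ≤⟨ +-monoʳ-≤ (toℕ last) (s≤s z≤n) ⟩
    toℕ last + suc (hamming u (tail (lookup vs last))) ≡⟨ cong (toℕ last +_) (sym (hamming-∷-≢ x u (lookup vs last) (x-avoids last (λ ()) ∘ sym))) ⟩
    toℕ last + hamming (x ∷ u) (lookup vs last)        ∎
  ... | no i≢last with i ≟ suc zero
  ...   | yes refl = s≤s (begin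
    suc (suc m)                             ≡⟨ sym (u-antipodal (suc zero) (λ ())) ⟩
    hamming u (tail (lookup vs (suc zero))) ≤⟨ hamming-tail-≤ x u (lookup vs (suc zero)) ⟩
    hamming (x ∷ u) (lookup vs (suc zero))  ∎)
  ...   | no i≢1 = begin
    suc (suc (suc m))                       ≡⟨ cong suc (sym (u-antipodal i i≢last)) ⟩
    suc (hamming u (tail (lookup vs i)))    ≡⟨ sym (hamming-∷-≢ x u (lookup vs i) (x-avoids i i≢1 ∘ sym)) ⟩
    hamming (x ∷ u) (lookup vs i)           ≤⟨ m≤n+m _ (toℕ i) ⟩
    toℕ i + hamming (x ∷ u) (lookup vs i)   ∎

length-n-¬burning : 3 ≤ n → n ≤ q → (vs : Vec (Vertex n q) n) → ¬ IsBurningSequence vs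
length-n-¬burning 3≤n n≤q vs with unreached-vertex 3≤n n≤q vs
... | u , unreached = unreached⇒¬burning {vs = vs} u unreached

proposition3p2 : (n q : ℕ) → 3 ≤ n → n ≤ q → BurningNumberIs n q (suc n)
proposition3p2 n q 3≤n n≤q = (replicate (suc n) o , burns-from-head (replicate (suc n) o) ≤-refl) , shorter-fails
  where
  o : Vertex n q
  o = replicate n (fromℕ< (≤-trans (s≤s z≤n) (≤-trans 3≤n n≤q)))
  shorter-fails : ∀ b → b < suc n → ¬ Σ (Vec (Vertex n q) b) IsBurningSequence
  shorter-fails b b<1+n burning with burning-lengthen o (≤⇒≤′ (≤-pred b<1+n)) burning
  ... | vs , burns = length-n-¬burning 3≤n n≤q vs burns
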